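{- Let $a>0$ and $b$ be relatively prime integers ($b$ may be negative). Let $f:\mathbb{N}\to\mathbb{N}$ be a function such that $f(aq+r)\ge f(r) - bq$ for all integers $0\le r<a$ and $q\ge1$. Then $$\langle a\rangle + \{af(y)+by : y\ge 0\} = \langle a\rangle \oplus \{af(r)+br : 0\le r<a\}.$$
   Context: $\mathbb{N}$ = nonnegative integers; $\langle a\rangle := \{an : n\in\mathbb{N}\}$. For sets $A,B$ of integers, $A+B := \{x+y : x\in A, y\in B\}$, and $C = A\oplus B$ means $C = A+B$ and every element of $C$ has a unique representation $x+y$ with $x\in A$, $y\in B$. -}

module Defs where

open import Level using (0ℓ)
open import Data.Nat using (ℕ)
open import Data.Integer using (ℤ; +_; _+_; _*_)
open import Data.Product using (Σ; ∃; _×_)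
open import Relation.Binary.PropositionalEquality using (_≡_)

SetZ : Set₁
SetZ = ℤ → Set

⟨_⟩ : ℤ → SetZ
⟨ a ⟩ x = ∃ λ (n : ℕ) → x ≡ a * + n

_⊹_ : SetZ → SetZ → SetZ
(A ⊹ B) z = ∃ λ x → ∃ λ y → A x × B y × z ≡ x + y

_≐_ : SetZ → SetZ → Set
C ≐ D = ∀ z → (C z → D z) × (D z → C z)

IsDirectSum : SetZ → SetZ → SetZ → Set
IsDirectSum C A B =
  (C ≐ (A ⊹ B)) ×
  (∀ x y x' y' → A x → B y → A x' → B y' → x + y ≡ x' + y' → (x ≡ x') × (y ≡ y'))

-- Write g y = a f(y) + b y. Every g y lies in ⟨a⟩ + {g r : r < a}: for y = aq + r with q ≥ 1,
-- g y = a (f y − f r + b q) + g r, and the hypothesis makes the coefficient f y − f r + b q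
-- nonnegative. Conversely the residue values g r are themselves values of g, so the two sumsets
-- agree. For directness, a n + g r = a n' + g r' forces a ∣ b (r − r'), hence a ∣ r − r' since
-- a and b are coprime, hence r = r' because |r − r'| < a.
module Submission where

open import Defs
open import Data.Nat using (ℕ; _<_; _≥_)
open import Data.Nat.Coprimality using (Coprime)
open import Data.Integer using (ℤ; +_; _+_; _-_; _*_; _≤_; ∣_∣)
open import Data.Product using (∃; _×_)
open import Relation.Binary.PropositionalEquality using (_≡_)

open import Algebra.Bundles using (AbelianGroup)
open import Data.Nat as ℕ using (zero; suc; s≤s; z≤n; NonZero; >-nonZero)
import Data.Nat.Properties as ℕ
open import Data.Nat.DivMod using (_/_; _%_; m%n<n; m≡m%n+[m/n]*n)
import Data.Nat.Divisibility as ℕ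
open import Data.Integer using (0ℤ)
open import Data.Integer.Divisibility using (divides) renaming (_∣_ to _∣ℤ_)
open import Data.Integer.Coprimality using (coprime-divisor)
import Data.Integer.Properties as ℤ
open import Data.Integer.Tactic.RingSolver using (solve-∀)
open import Data.Product using (_,_)
open import Relation.Binary.PropositionalEquality using (refl; sym; trans; cong; subst; module ≡-Reasoning)
open import Relation.Nullary using (contradiction)
open import Relation.Unary using (_⊆_)
open import Algebra.Properties.Group (AbelianGroup.group ℤ.+-0-abelianGroup) using (∙-cancelʳ)

⟨⟩⊹⟨⟩⊹⊆⟨⟩⊹ : ∀ a (A : SetZ) → (⟨ a ⟩ ⊹ (⟨ a ⟩ ⊹ A)) ⊆ (⟨ a ⟩ ⊹ A)
⟨⟩⊹⟨⟩⊹⊆⟨⟩⊹ a A (_ , _ , (n , refl) , (_ , w , (m , refl) , w∈A , refl) , refl) =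
  a * + (n ℕ.+ m) , w , (n ℕ.+ m , refl) , w∈A , eq
  where
  open ≡-Reasoning
  eq : a * + n + (a * + m + w) ≡ a * + (n ℕ.+ m) + w
  eq = begin
    a * + n + (a * + m + w)   ≡⟨ ℤ.+-assoc (a * + n) (a * + m) w ⟨
    a * + n + a * + m + w     ≡⟨ cong (_+ w) (ℤ.*-distribˡ-+ a (+ n) (+ m)) ⟨
    a * (+ n + + m) + w       ≡⟨ cong (λ k → a * k + w) (ℤ.pos-+ n m) ⟨
    a * + (n ℕ.+ m) + w       ∎

⟨⟩⊹-≐ : ∀ a {B C : SetZ} → B ⊆ (⟨ a ⟩ ⊹ C) → C ⊆ B → (⟨ a ⟩ ⊹ B) ≐ (⟨ a ⟩ ⊹ C)
⟨⟩⊹-≐ a {C = C} B⊆ C⊆B z = shrink , widen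
  where
  shrink : (⟨ a ⟩ ⊹ _) z → (⟨ a ⟩ ⊹ C) z
  shrink (x , w , x∈⟨a⟩ , w∈B , z≡) = ⟨⟩⊹⟨⟩⊹⊆⟨⟩⊹ a C (x , w , x∈⟨a⟩ , B⊆ w∈B , z≡)
  widen : (⟨ a ⟩ ⊹ C) z → (⟨ a ⟩ ⊹ _) z
  widen (x , w , x∈⟨a⟩ , w∈C , z≡) = x , w , x∈⟨a⟩ , C⊆B w∈C , z≡

m∣n⇒n<m⇒n≡0 : ∀ {m n} → m ℕ.∣ n → n < m → n ≡ 0
m∣n⇒n<m⇒n≡0 {n = zero}  _   _   = refl
m∣n⇒n<m⇒n≡0 {n = suc _} m∣n n<m = contradiction m∣n (ℕ.>⇒∤ n<m)

a∣m-n⇒m≡n : ∀ {a m n} → m < a → n < a → + a ∣ℤ + m - + n → m ≡ n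
a∣m-n⇒m≡n {a} {m} {n} m<a n<a a∣m-n = ℤ.+-injective (ℤ.i-j≡0⇒i≡j (+ m) (+ n) (ℤ.∣i∣≡0⇒i≡0 ∣m-n∣≡0))
  where
  ∣m-n∣<a : ∣ + m - + n ∣ < a
  ∣m-n∣<a = subst (_< a) (cong ∣_∣ (sym (ℤ.m-n≡m⊖n m n)))
    (ℕ.≤-<-trans (ℤ.∣m⊝n∣≤m⊔n m n) (ℕ.⊔-lub m<a n<a))
  ∣m-n∣≡0 : ∣ + m - + n ∣ ≡ 0
  ∣m-n∣≡0 = m∣n⇒n<m⇒n≡0 a∣m-n ∣m-n∣<a

a*i+b*j≡a*k+b*l⇒a∣b*[j-l] : ∀ a b i j k l → a * i + b * j ≡ a * k + b * l → a ∣ℤ b * (j - l)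
a*i+b*j≡a*k+b*l⇒a∣b*[j-l] a b i j k l eq =
  divides ∣ k - i ∣ (trans (cong ∣_∣ b[j-l]≡[k-i]a) (ℤ.abs-* (k - i) a))
  where
  open ≡-Reasoning
  difference : ∀ a b i j k l → b * (j - l) ≡ (k - i) * a + ((a * i + b * j) - (a * k + b * l))
  difference = solve-∀
  b[j-l]≡[k-i]a : b * (j - l) ≡ (k - i) * a
  b[j-l]≡[k-i]a = begin
    b * (j - l)                                       ≡⟨ difference a b i j k l ⟩
    (k - i) * a + ((a * i + b * j) - (a * k + b * l)) ≡⟨ cong (λ t → (k - i) * a + (t - (a * k + b * l))) eq ⟩
    (k - i) * a + ((a * k + b * l) - (a * k + b * l)) ≡⟨ cong (_+_ ((k - i) * a)) (ℤ.+-inverseʳ (a * k + b * l)) ⟩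
    (k - i) * a + 0ℤ                                  ≡⟨ ℤ.+-identityʳ _ ⟩
    (k - i) * a                                       ∎

module _ (a : ℕ) (b : ℤ) (f : ℕ → ℕ) where

  g : ℕ → ℤ
  g y = + a * + f y + b * + y

  Values : SetZ
  Values z = ∃ λ y → z ≡ g y

  ResidueValues : SetZ
  ResidueValues z = ∃ λ r → r < a × z ≡ g r

  ResidueValues⊆Values : ResidueValues ⊆ Values
  ResidueValues⊆Values (r , _ , z≡) = r , z≡

  g[aq+r]≡a*d+g[r] : ∀ q r → g (a ℕ.* q ℕ.+ r) ≡ + a * (+ f (a ℕ.* q ℕ.+ r) - (+ f r - b * + q)) + g r
  g[aq+r]≡a*d+g[r] q r = begin
    + a * + F + b * + (a ℕ.* q ℕ.+ r)      ≡⟨ cong (λ t → + a * + F + b * t) (ℤ.pos-+ (a ℕ.* q) r) ⟩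
    + a * + F + b * (+ (a ℕ.* q) + + r)    ≡⟨ cong (λ t → + a * + F + b * (t + + r)) (ℤ.pos-* a q) ⟩
    + a * + F + b * (+ a * + q + + r)      ≡⟨ regroup (+ a) b (+ q) (+ r) (+ F) (+ f r) ⟩
    + a * (+ F - (+ f r - b * + q)) + g r  ∎
    where
    open ≡-Reasoning
    F = f (a ℕ.* q ℕ.+ r)
    regroup : ∀ a b q r F Fr → a * F + b * (a * q + r) ≡ a * (F - (Fr - b * q)) + (a * Fr + b * r)
    regroup = solve-∀

  Values⊆⟨a⟩⊹ResidueValues : .{{_ : NonZero a}} →
    (∀ (r q : ℕ) → r < a → q ≥ 1 → (+ f r) - b * (+ q) ≤ + f (a ℕ.* q ℕ.+ r)) →
    Values ⊆ (⟨ + a ⟩ ⊹ ResidueValues)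
  Values⊆⟨a⟩⊹ResidueValues descent (y , refl) =
    subst (λ t → (⟨ + a ⟩ ⊹ ResidueValues) (g t)) (sym y≡aq+r) (reduce (y / a) (y % a) (m%n<n y a))
    where
    y≡aq+r : y ≡ a ℕ.* (y / a) ℕ.+ y % a
    y≡aq+r = trans (m≡m%n+[m/n]*n y a)
      (trans (ℕ.+-comm (y % a) _) (cong (ℕ._+ y % a) (ℕ.*-comm (y / a) a)))
    reduce : ∀ q r → r < a → (⟨ + a ⟩ ⊹ ResidueValues) (g (a ℕ.* q ℕ.+ r))
    reduce zero r r<a rewrite ℕ.*-zeroʳ a =
      0ℤ , g r , (0 , sym (ℤ.*-zeroʳ (+ a))) , (r , r<a , refl) , sym (ℤ.+-identityˡ (g r))
    reduce (suc q) r r<a =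
      + a * d , g r , (∣ d ∣ , cong (+ a *_) (sym (ℤ.0≤i⇒+∣i∣≡i 0≤d))) , (r , r<a , refl) ,
      g[aq+r]≡a*d+g[r] (suc q) r
      where
      d = + f (a ℕ.* suc q ℕ.+ r) - (+ f r - b * + suc q)
      0≤d : 0ℤ ≤ d
      0≤d = ℤ.i≤j⇒0≤j-i (descent r (suc q) r<a (s≤s z≤n))

  ⟨a⟩⊹ResidueValues-unique : Coprime a ∣ b ∣ → ∀ x y x' y' → ⟨ + a ⟩ x → ResidueValues y →
    ⟨ + a ⟩ x' → ResidueValues y' → x + y ≡ x' + y' → (x ≡ x') × (y ≡ y')
  ⟨a⟩⊹ResidueValues-unique coprime _ _ _ _ (n , refl) (r , r<a , refl) (n' , refl) (r' , r'<a , refl) eq =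
    ∙-cancelʳ (g r) (+ a * + n) (+ a * + n') (trans eq (cong (_+_ (+ a * + n')) (sym g[r]≡g[r']))) , g[r]≡g[r']
    where
    open ≡-Reasoning
    regroup : ∀ n r → + a * + n + g r ≡ + a * (+ n + + f r) + b * + r
    regroup n r = begin
      + a * + n + (+ a * + f r + b * + r)   ≡⟨ ℤ.+-assoc (+ a * + n) (+ a * + f r) (b * + r) ⟨
      + a * + n + + a * + f r + b * + r     ≡⟨ cong (_+ b * + r) (ℤ.*-distribˡ-+ (+ a) (+ n) (+ f r)) ⟨
      + a * (+ n + + f r) + b * + r         ∎
    a∣b*[r-r'] : + a ∣ℤ b * (+ r - + r')
    a∣b*[r-r'] = a*i+b*j≡a*k+b*l⇒a∣b*[j-l] (+ a) b _ (+ r) _ (+ r')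
      (trans (sym (regroup n r)) (trans eq (regroup n' r')))
    -- ℕ-coprimality of a and ∣ b ∣ is, by definition, ℤ-coprimality of + a and b.
    g[r]≡g[r'] : g r ≡ g r'
    g[r]≡g[r'] = cong g (a∣m-n⇒m≡n r<a r'<a (coprime-divisor (+ a) b (+ r - + r') coprime a∣b*[r-r']))

corollary4p2 : (a : ℕ) → (b : ℤ) → 0 < a → Coprime a ∣ b ∣ →
    (f : ℕ → ℕ) →
    (∀ (r q : ℕ) → r < a → q ≥ 1 →
    (+ f r) - b * (+ q) ≤ + f (Data.Nat._+_ (Data.Nat._*_ a q) r)) →
    IsDirectSum
    (⟨ + a ⟩ ⊹ (λ z → ∃ λ (y : ℕ) → z ≡ (+ a) * (+ f y) + b * (+ y)))
    ⟨ + a ⟩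
    (λ z → ∃ λ (r : ℕ) → r < a × z ≡ (+ a) * (+ f r) + b * (+ r))
corollary4p2 a b 0<a coprime f descent =
  ⟨⟩⊹-≐ (+ a) (Values⊆⟨a⟩⊹ResidueValues a b f {{>-nonZero 0<a}} descent) (ResidueValues⊆Values a b f) ,
  ⟨a⟩⊹ResidueValues-unique a b f coprime
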